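{- Let $p$ be a prime, let $n>m$ and $n'>m'$ be positive integers with $p\nmid m$ and $p\nmid n$, and suppose $m'\equiv m\pmod{p(p-1)}$ and $n'\equiv n\pmod{p(p-1)}$. Then for each choice of sign, $p^2\mid D_\pm(n,m)$ if and only if $p^2\mid D_\pm(n',m')$.
   Context: $D_\pm(n,m)=n^n\pm(n-m)^{n-m}m^m$ for positive integers $n>m$. -}

module Defs where

open import Data.Nat using (ℕ; _∸_)
open import Data.Integer using (ℤ; +_; _+_; _-_; _*_; _^_)

data Sign : Set where
  plus minus : Sign

D : Sign → ℕ → ℕ → ℤ
D plus  n m = (+ n) ^ n + (+ (n ∸ m)) ^ (n ∸ m) * (+ m) ^ m
D minus n m = (+ n) ^ n - (+ (n ∸ m)) ^ (n ∸ m) * (+ m) ^ m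

{-# OPTIONS --safe #-}
-- Put M = p(p - 1). For x, x' ≥ 1 with x' ≡ x (mod M) and δ = x' - x one has
-- x'^x' ≡ x^x (1 + δ) (mod p²): if p | x both sides vanish; otherwise x'^x' ≡ x'^x by
-- Euler's theorem modulo p² (Fermat's little theorem lifted through (1 + pt)^p ≡ 1), and
-- (x + δ)^x ≡ x^x + x·x^(x-1)·δ since p | δ. Applied to n, n - m and m, and discarding
-- the product of the two p-divisible shifts, this gives
-- D±(n', m') ≡ D±(n, m) (1 + n' - n) (mod p²), so p² | D±(n, m) implies p² | D±(n', m');
-- the converse is the same statement with the roles exchanged.
module Submission where

open import Defs
open import Data.Nat using (ℕ; _<_; _∸_) renaming (_*_ to _*ℕ_)
open import Data.Nat.Primality using (Prime)
open import Data.Integer using (ℤ; +_; _-_)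
open import Data.Integer.Divisibility using () renaming (_∣_ to _∣ℤ_)
open import Data.Nat.Divisibility using (_∤_)
open import Function.Bundles using (_⇔_)

open import Data.Empty using (⊥-elim)
open import Data.Product using (_,_)
open import Data.Sum using ([_,_]; [_,_]′)
open import Function.Base using (_∘_; id)
open import Function.Bundles using (mk⇔)
open import Data.Nat.Primality using (euclidsLemma; ¬prime[1])
open import Relation.Binary.PropositionalEquality
  using (_≡_; refl; sym; trans; cong; cong₂; subst; subst₂; module ≡-Reasoning)

module _ where
  open import Data.Nat
  open import Data.Nat.Properties
  open import Data.Nat.Divisibility
  open import Data.Nat.DivMod using (m/n*n≡m)
  open import Data.Nat.Combinatorics

  prime∤! : ∀ {p k} → Prime p → k < p → p ∤ k !
  prime∤! {k = zero}  pp _   p∣1  = ¬prime[1] (subst Prime (∣1⇒≡1 p∣1) pp)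
  prime∤! {k = suc k} pp k<p p∣k! =
    [ <⇒≱ k<p ∘ ∣⇒≤ , prime∤! pp (<-trans (n<1+n k) k<p) ]
      (euclidsLemma (suc k) (k !) pp p∣k!)

  prime∣C : ∀ {p k} → Prime p → 0 < k → k < p → p ∣ p C k
  prime∣C {suc q} {k} pp 0<k k<p =
    [ id , ⊥-elim ∘ [ prime∤! pp k<p , prime∤! pp p∸k<p ] ∘ euclidsLemma (k !) ((p ∸ k) !) pp ]
      (euclidsLemma (p C k) (k ! * (p ∸ k) !) pp (subst (p ∣_) p!≡C*k!*[p∸k]! (m∣m*n (q !))))
    where
    p = suc q
    p∸k<p : p ∸ k < p
    p∸k<p = ∸-monoʳ-< 0<k (<⇒≤ k<p)
    instance _ = k !* (p ∸ k) !≢0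
    p!≡C*k!*[p∸k]! : p ! ≡ (p C k) * (k ! * (p ∸ k) !)
    p!≡C*k!*[p∸k]! = begin
      p !                                         ≡⟨ m/n*n≡m (k![n∸k]!∣n! (<⇒≤ k<p)) ⟨
      p ! / (k ! * (p ∸ k) !) * (k ! * (p ∸ k) !) ≡⟨ cong (_* (k ! * (p ∸ k) !)) (nCk≡n!/k![n-k]! (<⇒≤ k<p)) ⟨
      (p C k) * (k ! * (p ∸ k) !)                   ∎
      where open ≡-Reasoning

open import Data.Nat as ℕ using (zero; suc)
import Data.Nat.Properties as ℕ
import Data.Nat.Divisibility as ℕ
open import Data.Integer using (_+_; _*_; -_; _^_; 0ℤ; 1ℤ; ∣_∣)
open import Data.Integer.Properties using (+-inverseʳ; *-assoc; ≤-⊖; m-n≡m⊖n; ^-zeroˡ; ^-*-assoc; ^-distribˡ-+-*; pos-*; abs-*; *-identityʳ)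
open import Data.Integer.Divisibility.Signed
  using (_∣_; divides; ∣-refl; ∣-trans; ∣m∣n⇒∣m+n; ∣m∣n⇒∣m-n; ∣m⇒∣-m; ∣n⇒∣m*n; ∣m⇒∣m*n;
         *-monoˡ-∣; *-monoʳ-∣; ∣ᵤ⇒∣; ∣⇒∣ᵤ; module ∣-Reasoning)
open import Data.Integer.Tactic.RingSolver using (solve; solve-∀)
open import Data.List using (_∷_; [])
open import Level using (0ℓ)
open import Relation.Binary.Bundles using (Setoid)
import Relation.Binary.Reasoning.Setoid as SetoidReasoning
open import Relation.Binary.Consequences using (wlog)
open import Relation.Nullary using (yes; no)

infix 4 _≡_mod_

record _≡_mod_ (a b n : ℤ) : Set where
  constructor ∣⇒≡-mod
  field ≡-mod⇒∣ : n ∣ a - b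

open _≡_mod_

module _ {n : ℤ} where

  ≡⇒≡-mod : ∀ {a b} → a ≡ b → a ≡ b mod n
  ≡⇒≡-mod {a} refl = ∣⇒≡-mod (divides 0ℤ (+-inverseʳ a))

  ≡-mod-refl : ∀ a → a ≡ a mod n
  ≡-mod-refl a = ≡⇒≡-mod {a} refl

  ≡-mod-sym : ∀ {a b} → a ≡ b mod n → b ≡ a mod n
  ≡-mod-sym {a} {b} (∣⇒≡-mod n∣a-b) = ∣⇒≡-mod (begin
    n         ∣⟨ ∣m⇒∣-m n∣a-b ⟩
    - (a - b) ≡⟨ solve (a ∷ b ∷ []) ⟩
    b - a     ∎)
    where open ∣-Reasoning

  ≡-mod-trans : ∀ {a b c} → a ≡ b mod n → b ≡ c mod n → a ≡ c mod n
  ≡-mod-trans {a} {b} {c} (∣⇒≡-mod n∣a-b) (∣⇒≡-mod n∣b-c) = ∣⇒≡-mod (begin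
    n                 ∣⟨ ∣m∣n⇒∣m+n n∣a-b n∣b-c ⟩
    (a - b) + (b - c) ≡⟨ solve (a ∷ b ∷ c ∷ []) ⟩
    a - c             ∎)
    where open ∣-Reasoning

  +-cong-mod : ∀ {a b c d} → a ≡ b mod n → c ≡ d mod n → a + c ≡ b + d mod n
  +-cong-mod {a} {b} {c} {d} (∣⇒≡-mod n∣a-b) (∣⇒≡-mod n∣c-d) = ∣⇒≡-mod (begin
    n                   ∣⟨ ∣m∣n⇒∣m+n n∣a-b n∣c-d ⟩
    (a - b) + (c - d)   ≡⟨ solve (a ∷ b ∷ c ∷ d ∷ []) ⟩
    (a + c) - (b + d)   ∎)
    where open ∣-Reasoning

  -‿cong-mod : ∀ {a b c d} → a ≡ b mod n → c ≡ d mod n → a - c ≡ b - d mod n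
  -‿cong-mod {a} {b} {c} {d} (∣⇒≡-mod n∣a-b) (∣⇒≡-mod n∣c-d) = ∣⇒≡-mod (begin
    n                   ∣⟨ ∣m∣n⇒∣m-n n∣a-b n∣c-d ⟩
    (a - b) - (c - d)   ≡⟨ solve (a ∷ b ∷ c ∷ d ∷ []) ⟩
    (a - c) - (b - d)   ∎)
    where open ∣-Reasoning

  *-cong-mod : ∀ {a b c d} → a ≡ b mod n → c ≡ d mod n → a * c ≡ b * d mod n
  *-cong-mod {a} {b} {c} {d} (∣⇒≡-mod n∣a-b) (∣⇒≡-mod n∣c-d) = ∣⇒≡-mod (begin
    n                           ∣⟨ ∣m∣n⇒∣m+n (∣m⇒∣m*n c n∣a-b) (∣n⇒∣m*n b n∣c-d) ⟩
    (a - b) * c + b * (c - d)   ≡⟨ solve (a ∷ b ∷ c ∷ d ∷ []) ⟩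
    a * c - b * d               ∎)
    where open ∣-Reasoning

  *-congˡ-mod : ∀ a {c d} → c ≡ d mod n → a * c ≡ a * d mod n
  *-congˡ-mod a = *-cong-mod (≡-mod-refl a)

  ^-cong-mod : ∀ {a b} k → a ≡ b mod n → a ^ k ≡ b ^ k mod n
  ^-cong-mod zero    a≡b = ≡-mod-refl 1ℤ
  ^-cong-mod (suc k) a≡b = *-cong-mod a≡b (^-cong-mod k a≡b)

  +-multipleʳ-mod : ∀ a {t} → n ∣ t → a + t ≡ a mod n
  +-multipleʳ-mod a {t} n∣t = ∣⇒≡-mod (begin
    n           ∣⟨ n∣t ⟩
    t           ≡⟨ solve (a ∷ t ∷ []) ⟩
    (a + t) - a ∎)
    where open ∣-Reasoning

  ∣-resp-≡-mod : ∀ {d a b} → d ∣ n → a ≡ b mod n → d ∣ b → d ∣ a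
  ∣-resp-≡-mod {d} {a} {b} d∣n (∣⇒≡-mod n∣a-b) d∣b = begin
    d                 ∣⟨ ∣m∣n⇒∣m+n (∣-trans d∣n n∣a-b) d∣b ⟩
    (a - b) + b       ≡⟨ solve (a ∷ b ∷ []) ⟩
    a                 ∎
    where open ∣-Reasoning

≡-mod-setoid : ℤ → Setoid 0ℓ 0ℓ
≡-mod-setoid n = record
  { _≈_           = λ a b → a ≡ b mod n
  ; isEquivalence = record { refl = ≡-mod-refl _ ; sym = ≡-mod-sym ; trans = ≡-mod-trans }
  }

module ≡-mod-Reasoning (n : ℤ) = SetoidReasoning (≡-mod-setoid n)

*-pres-∣ : ∀ {a b c d} → a ∣ b → c ∣ d → a * c ∣ b * d
*-pres-∣ {b = b} {c} a∣b c∣d = ∣-trans (*-monoˡ-∣ c a∣b) (*-monoʳ-∣ b c∣d)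

binomial-approx : ∀ {d} x δ → d ∣ δ → ∀ k →
                  (x + δ) ^ suc k ≡ x ^ suc k + + suc k * x ^ k * δ mod (d * d)
binomial-approx x δ _ zero = ≡⇒≡-mod (expand₀ x δ)
  where
  expand₀ : ∀ x δ → (x + δ) * 1ℤ ≡ x * 1ℤ + 1ℤ * 1ℤ * δ
  expand₀ = solve-∀
binomial-approx {d} x δ d∣δ (suc k) = begin
  (x + δ) * (x + δ) ^ suc k
    ≈⟨ *-congˡ-mod (x + δ) (binomial-approx x δ d∣δ k) ⟩
  (x + δ) * (x * x ^ k + + suc k * x ^ k * δ)
    ≡⟨ expand x δ (x ^ k) (+ suc k) ⟩
  x * (x * x ^ k) + (1ℤ + + suc k) * (x * x ^ k) * δ + + suc k * x ^ k * (δ * δ)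
    ≈⟨ +-multipleʳ-mod _ (∣n⇒∣m*n (+ suc k * x ^ k) (*-pres-∣ d∣δ d∣δ)) ⟩
  x ^ suc (suc k) + + suc (suc k) * x ^ suc k * δ
    ∎
  where
  open ≡-mod-Reasoning (d * d)
  expand : ∀ x δ X c → (x + δ) * (x * X + c * X * δ)
                       ≡ x * (x * X) + (1ℤ + c) * (x * X) * δ + c * X * (δ * δ)
  expand = solve-∀

[1+δ]^p≡1 : ∀ {p δ} → + p ∣ δ → (1ℤ + δ) ^ p ≡ 1ℤ mod (+ p * + p)
[1+δ]^p≡1 {zero}  _   = ≡⇒≡-mod refl
[1+δ]^p≡1 {suc k} {δ} p∣δ = begin
  (1ℤ + δ) ^ suc k                    ≈⟨ binomial-approx 1ℤ δ p∣δ k ⟩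
  1ℤ * 1ℤ ^ k + + suc k * 1ℤ ^ k * δ  ≡⟨ cong (λ u → 1ℤ * u + + suc k * u * δ) (^-zeroˡ k) ⟩
  1ℤ * 1ℤ + + suc k * 1ℤ * δ          ≈⟨ +-multipleʳ-mod (1ℤ * 1ℤ) (*-pres-∣ (∣m⇒∣m*n 1ℤ (∣-refl {+ suc k})) p∣δ) ⟩
  1ℤ                                  ∎
  where open ≡-mod-Reasoning (+ suc k * + suc k)

module _ where
  open import Algebra.Bundles using (CommutativeSemiring)
  open import Data.Fin using (Fin; zero; suc; toℕ; fromℕ; inject₁)
  open import Data.Fin.Properties using (toℕ-fromℕ; toℕ<n; toℕ-inject₁)
  open import Data.Integer.Properties using (+-*-commutativeSemiring; +-0-monoid; +-comm; *-identityˡ)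
  open import Data.Nat.Combinatorics using (_C_; nCn≡1)
  open import Data.Vec.Functional using (Vector; init)
  open import Algebra.Definitions.RawSemiring (CommutativeSemiring.rawSemiring +-*-commutativeSemiring)
    using (_×_; sum) renaming (_^_ to _^ₛ_)
  open import Algebra.Properties.Monoid.Sum +-0-monoid using (sum-init-last)
  import Algebra.Properties.CommutativeSemiring.Binomial +-*-commutativeSemiring as Binomial

  ×≡* : ∀ k x → k × x ≡ + k * x
  ×≡* zero    x = refl
  ×≡* (suc k) x = trans (cong (_+_ x) (×≡* k x)) (distrib x (+ k))
    where
    distrib : ∀ x c → x + c * x ≡ (1ℤ + c) * x
    distrib = solve-∀

  ^ₛ≡^ : ∀ x k → x ^ₛ k ≡ x ^ k
  ^ₛ≡^ x zero    = refl
  ^ₛ≡^ x (suc k) = cong (x *_) (^ₛ≡^ x k)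

  ∣-sum : ∀ {d k} (f : Vector ℤ k) → (∀ i → d ∣ f i) → d ∣ sum f
  ∣-sum {k = zero}  f _   = divides 0ℤ refl
  ∣-sum {k = suc k} f d∣f = ∣m∣n⇒∣m+n (d∣f zero) (∣-sum (f ∘ suc) (d∣f ∘ suc))

  binomialTerm-1+x : ∀ x n i →
                     Binomial.binomialTerm 1ℤ x n i ≡ + (n C toℕ i) * x ^ (n ∸ toℕ i)
  binomialTerm-1+x x n i = begin
    (n C k) × (1ℤ ^ₛ k * x ^ₛ (n ∸ k))   ≡⟨ ×≡* (n C k) _ ⟩
    + (n C k) * (1ℤ ^ₛ k * x ^ₛ (n ∸ k)) ≡⟨ cong₂ (λ u v → + (n C k) * (u * v)) 1^ₛk≡1 (^ₛ≡^ x (n ∸ k)) ⟩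
    + (n C k) * (1ℤ * x ^ (n ∸ k))       ≡⟨ cong (_*_ (+ (n C k))) (*-identityˡ _) ⟩
    + (n C k) * x ^ (n ∸ k)              ∎
    where
    open ≡-Reasoning
    k = toℕ i
    1^ₛk≡1 : 1ℤ ^ₛ k ≡ 1ℤ
    1^ₛk≡1 = trans (^ₛ≡^ 1ℤ k) (^-zeroˡ k)

  binomialTerm-first : ∀ x q → Binomial.binomialTerm 1ℤ x (suc q) zero ≡ x ^ suc q
  binomialTerm-first x q = trans (binomialTerm-1+x x (suc q) zero) (*-identityˡ (x ^ suc q))

  binomialTerm-last : ∀ x n → Binomial.binomialTerm 1ℤ x n (fromℕ n) ≡ 1ℤ
  binomialTerm-last x n = begin
    Binomial.binomialTerm 1ℤ x n (fromℕ n) ≡⟨ binomialTerm-1+x x n (fromℕ n) ⟩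
    + (n C toℕ (fromℕ n)) * x ^ (n ∸ toℕ (fromℕ n)) ≡⟨ cong (λ k → + (n C k) * x ^ (n ∸ k)) (toℕ-fromℕ n) ⟩
    + (n C n) * x ^ (n ∸ n)                          ≡⟨ cong₂ (λ c e → + c * x ^ e) (nCn≡1 n) (ℕ.n∸n≡0 n) ⟩
    1ℤ                                               ∎
    where open ≡-Reasoning

  freshman : ∀ {p} → Prime p → ∀ x → (1ℤ + x) ^ p ≡ 1ℤ + x ^ p mod + p
  freshman {p@(suc q)} pp x = begin
    (1ℤ + x) ^ p                       ≡⟨ ^ₛ≡^ (1ℤ + x) p ⟨
    (1ℤ + x) ^ₛ p                      ≡⟨ Binomial.theorem p 1ℤ x ⟩
    T zero + sum (T ∘ suc)             ≡⟨ cong (_+_ (T zero)) (sum-init-last (T ∘ suc)) ⟩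
    T zero + (sum middle + T (fromℕ p)) ≡⟨ regroup (T zero) (sum middle) (T (fromℕ p)) ⟩
    (T zero + T (fromℕ p)) + sum middle ≈⟨ +-multipleʳ-mod (T zero + T (fromℕ p)) (∣-sum middle p∣middle) ⟩
    T zero + T (fromℕ p)               ≡⟨ cong₂ _+_ (binomialTerm-first x q) (binomialTerm-last x p) ⟩
    x ^ p + 1ℤ                         ≡⟨ +-comm (x ^ p) 1ℤ ⟩
    1ℤ + x ^ p                         ∎
    where
    open ≡-mod-Reasoning (+ p)
    T : Fin (suc p) → ℤ
    T = Binomial.binomialTerm 1ℤ x p
    middle : Vector ℤ q
    middle = init (T ∘ suc)
    regroup : ∀ a b c → a + (b + c) ≡ (a + c) + b
    regroup = solve-∀
    p∣middle : ∀ i → + p ∣ middle i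
    p∣middle i = subst (+ p ∣_) (sym (binomialTerm-1+x x p (suc (inject₁ i))))
                   (∣m⇒∣m*n (x ^ (p ∸ k)) (∣ᵤ⇒∣ {+ p} {+ (p C k)} (prime∣C pp ℕ.z<s k<p)))
      where
      k = suc (toℕ (inject₁ i))
      k<p : k ℕ.< p
      k<p = ℕ.s≤s (subst (ℕ._< q) (sym (toℕ-inject₁ i)) (toℕ<n i))

fermat : ∀ {p} → Prime p → ∀ a → (+ a) ^ p ≡ + a mod + p
fermat {suc q} pp zero    = ≡⇒≡-mod refl
fermat {p}     pp (suc a) = begin
  (1ℤ + + a) ^ p ≈⟨ freshman pp (+ a) ⟩
  1ℤ + (+ a) ^ p ≈⟨ +-cong-mod (≡-mod-refl 1ℤ) (fermat pp a) ⟩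
  1ℤ + + a       ∎
  where open ≡-mod-Reasoning (+ p)

prime∣*⇒∣ : ∀ {p a y} → Prime p → p ∤ a → + p ∣ + a * y → + p ∣ y
prime∣*⇒∣ {p} {a} {y} pp p∤a p∣ay =
  [ ⊥-elim ∘ p∤a , ∣ᵤ⇒∣ {+ p} {y} ]′ (euclidsLemma a ∣ y ∣ pp (subst (p ℕ.∣_) (abs-* (+ a) y) (∣⇒∣ᵤ p∣ay)))

fermat-coprime : ∀ {p a} → Prime p → p ∤ a → (+ a) ^ (p ∸ 1) ≡ 1ℤ mod + p
fermat-coprime {suc q} {a} pp p∤a = ∣⇒≡-mod (prime∣*⇒∣ pp p∤a (begin
  + suc q                      ∣⟨ ≡-mod⇒∣ (fermat pp a) ⟩
  + a * (+ a) ^ q - + a        ≡⟨ factor (+ a) ((+ a) ^ q) ⟩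
  + a * ((+ a) ^ q - 1ℤ)       ∎))
  where
  open ∣-Reasoning
  factor : ∀ u U → u * U - u ≡ u * (U - 1ℤ)
  factor = solve-∀

euler-mod-p² : ∀ {p a} → Prime p → p ∤ a → (+ a) ^ (p *ℕ (p ∸ 1)) ≡ 1ℤ mod (+ p * + p)
euler-mod-p² {p} {a} pp p∤a = begin
  (+ a) ^ (p *ℕ (p ∸ 1))       ≡⟨ cong ((+ a) ^_) (ℕ.*-comm p (p ∸ 1)) ⟩
  (+ a) ^ ((p ∸ 1) *ℕ p)       ≡⟨ ^-*-assoc (+ a) (p ∸ 1) p ⟨
  ((+ a) ^ (p ∸ 1)) ^ p        ≡⟨ cong (_^ p) (split ((+ a) ^ (p ∸ 1))) ⟩
  (1ℤ + ((+ a) ^ (p ∸ 1) - 1ℤ)) ^ p ≈⟨ [1+δ]^p≡1 (≡-mod⇒∣ (fermat-coprime pp p∤a)) ⟩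
  1ℤ                           ∎
  where
  open ≡-mod-Reasoning (+ p * + p)
  split : ∀ u → u ≡ 1ℤ + (u - 1ℤ)
  split = solve-∀

^-period-mod-p² : ∀ {p u e} → Prime p → p ∤ u → (p *ℕ (p ∸ 1)) ℕ.∣ e →
                  (+ u) ^ e ≡ 1ℤ mod (+ p * + p)
^-period-mod-p² {p} {u} pp p∤u (ℕ.divides c refl) = begin
  (+ u) ^ (c *ℕ M)   ≡⟨ cong ((+ u) ^_) (ℕ.*-comm c M) ⟩
  (+ u) ^ (M *ℕ c)   ≡⟨ ^-*-assoc (+ u) M c ⟨
  ((+ u) ^ M) ^ c    ≈⟨ ^-cong-mod c (euler-mod-p² pp p∤u) ⟩
  1ℤ ^ c             ≡⟨ ^-zeroˡ c ⟩
  1ℤ                 ∎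
  where
  open ≡-mod-Reasoning (+ p * + p)
  M = p *ℕ (p ∸ 1)

^-exponent-mod-p[p-1] : ∀ {p u} → Prime p → p ∤ u → ∀ a b →
             + a ≡ + b mod + (p *ℕ (p ∸ 1)) → (+ u) ^ a ≡ (+ u) ^ b mod (+ p * + p)
^-exponent-mod-p[p-1] {p} {u} pp p∤u = wlog (λ a b → ℕ.≤-total b a) (λ f → ≡-mod-sym ∘ f ∘ ≡-mod-sym) shift
  where
  open ≡-mod-Reasoning (+ p * + p)
  shift : ∀ a b → b ℕ.≤ a → + a ≡ + b mod + (p *ℕ (p ∸ 1)) → (+ u) ^ a ≡ (+ u) ^ b mod (+ p * + p)
  shift a b b≤a a≡b with ℕ.m≤n⇒∃[o]m+o≡n b≤a
  ... | e , refl = begin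
    (+ u) ^ (b ℕ.+ e)       ≡⟨ ^-distribˡ-+-* (+ u) b e ⟩
    (+ u) ^ b * (+ u) ^ e   ≈⟨ *-congˡ-mod ((+ u) ^ b) (^-period-mod-p² pp p∤u M∣e) ⟩
    (+ u) ^ b * 1ℤ          ≡⟨ *-identityʳ ((+ u) ^ b) ⟩
    (+ u) ^ b               ∎
    where
    cancel : ∀ x y → (x + y) - x ≡ y
    cancel = solve-∀
    M∣e : (p *ℕ (p ∸ 1)) ℕ.∣ e
    M∣e = subst ((p *ℕ (p ∸ 1)) ℕ.∣_) (cong ∣_∣ (cancel (+ b) (+ e))) (∣⇒∣ᵤ (≡-mod⇒∣ a≡b))

∣⇒*∣^[2+k] : ∀ {d x} k → d ∣ x → d * d ∣ x ^ suc (suc k)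
∣⇒*∣^[2+k] {d} {x} k d∣x = begin
  d * d               ∣⟨ ∣m⇒∣m*n (x ^ k) (*-pres-∣ d∣x d∣x) ⟩
  x * x * x ^ k       ≡⟨ *-assoc x x (x ^ k) ⟩
  x * (x * x ^ k)     ∎
  where open ∣-Reasoning

prime∣x⇒p²∣x^x : ∀ {p x} → Prime p → 0 ℕ.< x → p ℕ.∣ x → + p * + p ∣ (+ x) ^ x
prime∣x⇒p²∣x^x {x = 1} pp _ p∣1 = ⊥-elim (¬prime[1] (subst Prime (ℕ.∣1⇒≡1 p∣1) pp))
prime∣x⇒p²∣x^x {p} {suc (suc k)} pp _ p∣x = ∣⇒*∣^[2+k] k (∣ᵤ⇒∣ {+ p} {+ suc (suc k)} p∣x)

p∣p[p-1] : ∀ p → + p ∣ + (p *ℕ (p ∸ 1))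
p∣p[p-1] p = ∣ᵤ⇒∣ (ℕ.m∣m*n (p ∸ 1))

self-power-shift : ∀ {p x x′} → Prime p → 0 ℕ.< x → 0 ℕ.< x′ →
                   + x′ ≡ + x mod + (p *ℕ (p ∸ 1)) →
                   (+ x′) ^ x′ ≡ (+ x) ^ x * (1ℤ + (+ x′ - + x)) mod (+ p * + p)
self-power-shift {p} {x@(suc k)} {x′} pp 0<x 0<x′ x′≡x with p ℕ.∣? x
... | yes p∣x = ∣⇒≡-mod (∣m∣n⇒∣m-n (prime∣x⇒p²∣x^x pp 0<x′ p∣x′)
                                     (∣m⇒∣m*n (1ℤ + (+ x′ - + x)) (prime∣x⇒p²∣x^x pp 0<x p∣x)))
  where
  p∣x′ : p ℕ.∣ x′
  p∣x′ = ∣⇒∣ᵤ (∣-resp-≡-mod (p∣p[p-1] p) x′≡x (∣ᵤ⇒∣ p∣x))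
... | no p∤x = begin
  (+ x′) ^ x′                       ≈⟨ ^-exponent-mod-p[p-1] pp p∤x′ x′ x x′≡x ⟩
  (+ x′) ^ x                        ≡⟨ cong (_^ x) (split (+ x′) (+ x)) ⟩
  (+ x + δ) ^ x                     ≈⟨ binomial-approx (+ x) δ p∣δ k ⟩
  (+ x) ^ x + + x * (+ x) ^ k * δ   ≡⟨ factor (+ x) ((+ x) ^ k) δ ⟩
  (+ x) ^ x * (1ℤ + δ)              ∎
  where
  open ≡-mod-Reasoning (+ p * + p)
  δ = + x′ - + x
  p∣δ : + p ∣ δ
  p∣δ = ∣-trans (p∣p[p-1] p) (≡-mod⇒∣ x′≡x)
  p∤x′ : p ∤ x′
  p∤x′ p∣x′ = p∤x (∣⇒∣ᵤ (∣-resp-≡-mod (p∣p[p-1] p) (≡-mod-sym x′≡x) (∣ᵤ⇒∣ p∣x′)))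
  split : ∀ y z → y ≡ z + (y - z)
  split = solve-∀
  factor : ∀ y Y δ → y * Y + y * Y * δ ≡ y * Y * (1ℤ + δ)
  factor = solve-∀

A[1+u]*Q[1+v]≡AQ[1+u+v] : ∀ {d u v} A Q → d ∣ u → d ∣ v →
                          A * (1ℤ + u) * (Q * (1ℤ + v)) ≡ A * Q * (1ℤ + (u + v)) mod (d * d)
A[1+u]*Q[1+v]≡AQ[1+u+v] {d} {u} {v} A Q d∣u d∣v = begin
  A * (1ℤ + u) * (Q * (1ℤ + v))             ≡⟨ solve (A ∷ Q ∷ u ∷ v ∷ []) ⟩
  A * Q * (1ℤ + (u + v)) + A * Q * (u * v)  ≈⟨ +-multipleʳ-mod _ (∣n⇒∣m*n (A * Q) (*-pres-∣ d∣u d∣v)) ⟩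
  A * Q * (1ℤ + (u + v))                    ∎
  where open ≡-mod-Reasoning (d * d)

infixl 6 _±⟨_⟩_

_±⟨_⟩_ : ℤ → Sign → ℤ → ℤ
a ±⟨ plus  ⟩ b = a + b
a ±⟨ minus ⟩ b = a - b

D≡± : ∀ s n m → D s n m ≡ (+ n) ^ n ±⟨ s ⟩ (+ (n ∸ m)) ^ (n ∸ m) * (+ m) ^ m
D≡± plus  _ _ = refl
D≡± minus _ _ = refl

±-cong-mod : ∀ {n a b c d} s → a ≡ b mod n → c ≡ d mod n → a ±⟨ s ⟩ c ≡ b ±⟨ s ⟩ d mod n
±-cong-mod plus  = +-cong-mod
±-cong-mod minus = -‿cong-mod

*-distribʳ-± : ∀ s a b c → (a ±⟨ s ⟩ b) * c ≡ a * c ±⟨ s ⟩ b * c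
*-distribʳ-± plus  = distrib-plus
  where
  distrib-plus : ∀ a b c → (a + b) * c ≡ a * c + b * c
  distrib-plus = solve-∀
*-distribʳ-± minus = distrib-minus
  where
  distrib-minus : ∀ a b c → (a - b) * c ≡ a * c - b * c
  distrib-minus = solve-∀

+[m∸n]≡+m-+n : ∀ {m n} → n ℕ.≤ m → + (m ∸ n) ≡ + m - + n
+[m∸n]≡+m-+n {m} {n} n≤m = trans (sym (≤-⊖ n≤m)) (sym (m-n≡m⊖n m n))

D-shift : ∀ {p n m n′ m′} → Prime p → 0 ℕ.< m → m ℕ.< n → 0 ℕ.< m′ → m′ ℕ.< n′ →
          + m′ ≡ + m mod + (p *ℕ (p ∸ 1)) → + n′ ≡ + n mod + (p *ℕ (p ∸ 1)) → ∀ s →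
          D s n′ m′ ≡ D s n m * (1ℤ + (+ n′ - + n)) mod (+ p * + p)
D-shift {p} {n} {m} {n′} {m′} pp 0<m m<n 0<m′ m′<n′ m′≡m n′≡n s = begin
  D s n′ m′                                              ≡⟨ D≡± s n′ m′ ⟩
  N′ ±⟨ s ⟩ A′ * Q′
    ≈⟨ ±-cong-mod s (self-power-shift pp 0<n 0<n′ n′≡n)
                    (*-cong-mod (self-power-shift pp 0<a 0<a′ a′≡a) (self-power-shift pp 0<m 0<m′ m′≡m)) ⟩
  N * (1ℤ + Δn) ±⟨ s ⟩ A * (1ℤ + Δa) * (Q * (1ℤ + Δm))
    ≈⟨ ±-cong-mod s (≡-mod-refl (N * (1ℤ + Δn))) (A[1+u]*Q[1+v]≡AQ[1+u+v] A Q p∣Δa p∣Δm) ⟩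
  N * (1ℤ + Δn) ±⟨ s ⟩ A * Q * (1ℤ + (Δa + Δm))         ≡⟨ cong (λ t → N * (1ℤ + Δn) ±⟨ s ⟩ A * Q * (1ℤ + t)) Δa+Δm≡Δn ⟩
  N * (1ℤ + Δn) ±⟨ s ⟩ A * Q * (1ℤ + Δn)                ≡⟨ *-distribʳ-± s N (A * Q) (1ℤ + Δn) ⟨
  (N ±⟨ s ⟩ A * Q) * (1ℤ + Δn)                          ≡⟨ cong (_* (1ℤ + Δn)) (D≡± s n m) ⟨
  D s n m * (1ℤ + Δn)                                    ∎
  where
  open ≡-mod-Reasoning (+ p * + p)
  a  = n ∸ m
  a′ = n′ ∸ m′
  N  = (+ n) ^ n
  A  = (+ a) ^ a
  Q  = (+ m) ^ m
  N′ = (+ n′) ^ n′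
  A′ = (+ a′) ^ a′
  Q′ = (+ m′) ^ m′
  Δn = + n′ - + n
  Δm = + m′ - + m
  Δa = + a′ - + a
  0<n  = ℕ.<-trans 0<m m<n
  0<n′ = ℕ.<-trans 0<m′ m′<n′
  0<a  = ℕ.m<n⇒0<n∸m m<n
  0<a′ = ℕ.m<n⇒0<n∸m m′<n′
  +a≡ : + a ≡ + n - + m
  +a≡ = +[m∸n]≡+m-+n (ℕ.<⇒≤ m<n)
  +a′≡ : + a′ ≡ + n′ - + m′
  +a′≡ = +[m∸n]≡+m-+n (ℕ.<⇒≤ m′<n′)
  a′≡a : + a′ ≡ + a mod + (p *ℕ (p ∸ 1))
  a′≡a = subst₂ (λ u v → u ≡ v mod + (p *ℕ (p ∸ 1))) (sym +a′≡) (sym +a≡) (-‿cong-mod n′≡n m′≡m)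
  p∣Δa : + p ∣ Δa
  p∣Δa = ∣-trans (p∣p[p-1] p) (≡-mod⇒∣ a′≡a)
  p∣Δm : + p ∣ Δm
  p∣Δm = ∣-trans (p∣p[p-1] p) (≡-mod⇒∣ m′≡m)
  telescope : ∀ n′ m′ n m → ((n′ - m′) - (n - m)) + (m′ - m) ≡ n′ - n
  telescope = solve-∀
  Δa+Δm≡Δn : Δa + Δm ≡ Δn
  Δa+Δm≡Δn = trans (cong₂ (λ u v → (u - v) + Δm) +a′≡ +a≡) (telescope (+ n′) (+ m′) (+ n) (+ m))

p²∣D⇒p²∣D : ∀ {p n m n′ m′} → Prime p → 0 ℕ.< m → m ℕ.< n → 0 ℕ.< m′ → m′ ℕ.< n′ →
            + m′ ≡ + m mod + (p *ℕ (p ∸ 1)) → + n′ ≡ + n mod + (p *ℕ (p ∸ 1)) → ∀ s →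
            + p * + p ∣ D s n m → + p * + p ∣ D s n′ m′
p²∣D⇒p²∣D pp 0<m m<n 0<m′ m′<n′ m′≡m n′≡n s p²∣D =
  ∣-resp-≡-mod ∣-refl (D-shift pp 0<m m<n 0<m′ m′<n′ m′≡m n′≡n s) (∣m⇒∣m*n _ p²∣D)

lemma3p1 : (p n m n′ m′ : ℕ) → Prime p →
           0 < m → m < n → 0 < m′ → m′ < n′ →
           p ∤ m → p ∤ n →
           (+ (p *ℕ (p ∸ 1))) ∣ℤ ((+ m′) - (+ m)) →
           (+ (p *ℕ (p ∸ 1))) ∣ℤ ((+ n′) - (+ n)) →
           (s : Sign) →
           ((+ (p *ℕ p)) ∣ℤ D s n m) ⇔ ((+ (p *ℕ p)) ∣ℤ D s n′ m′)
lemma3p1 p n m n′ m′ pp 0<m m<n 0<m′ m′<n′ _ _ M∣m′-m M∣n′-n s = mk⇔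
  (unsigned ∘ p²∣D⇒p²∣D pp 0<m m<n 0<m′ m′<n′ m′≡m n′≡n s ∘ signed)
  (unsigned ∘ p²∣D⇒p²∣D pp 0<m′ m′<n′ 0<m m<n (≡-mod-sym m′≡m) (≡-mod-sym n′≡n) s ∘ signed)
  where
  m′≡m : + m′ ≡ + m mod + (p *ℕ (p ∸ 1))
  m′≡m = ∣⇒≡-mod (∣ᵤ⇒∣ M∣m′-m)
  n′≡n : + n′ ≡ + n mod + (p *ℕ (p ∸ 1))
  n′≡n = ∣⇒≡-mod (∣ᵤ⇒∣ M∣n′-n)
  signed : ∀ {z} → + (p *ℕ p) ∣ℤ z → + p * + p ∣ z
  signed = subst (_∣ _) (pos-* p p) ∘ ∣ᵤ⇒∣
  unsigned : ∀ {z} → + p * + p ∣ z → + (p *ℕ p) ∣ℤ z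
  unsigned = ∣⇒∣ᵤ ∘ subst (_∣ _) (sym (pos-* p p))
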